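{- Let $G$ and $G'$ be cactuses. Then $G$ and $G'$ are isomorphic if and only if $R(G)\sim R(G')$, i.e., there is a bijection $f:R(G)\to R(G')$ such that $f(D)$ is isomorphic to $D$ for all $D\in R(G)$.
   Context: A cactus is a finite connected undirected graph in which any two cycles are edge-disjoint. A rooted cactus is a finite directed acyclic graph with exactly one vertex of indegree 0 (the root), every vertex reachable from the root by a directed path, whose underlying undirected graph is a cactus. For a cactus $G$, $R(G)$ is the set of all rooted cactuses obtainable from $G$ by choosing a vertex as root and choosing an orientation of each edge of $G$ (distinct choices give distinct elements of $R(G)$, which may nevertheless be isomorphic digraphs). -}

module Defs where

open import Data.Nat using (ℕ; zero; suc; _≤_; _∸_)
open import Data.Fin using (Fin; toℕ)
open import Data.Bool using (Bool; true; false)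
open import Data.Vec using (Vec; lookup)
open import Data.Product using (Σ; ∃; _×_; _,_; proj₁)
open import Data.Sum using (_⊎_)
open import Relation.Nullary using (¬_)
open import Relation.Binary.PropositionalEquality using (_≡_)
open import Function.Bundles using (_↔_; Inverse)

record Graph (n : ℕ) : Set where
  field
    adj    : Fin n → Fin n → Bool
    sym    : ∀ i j → adj i j ≡ adj j i
    irrefl : ∀ i → adj i i ≡ false

open Graph public

Edge : ∀ {n} → Graph n → Fin n → Fin n → Set
Edge G i j = adj G i j ≡ true

data Walk {n} (G : Graph n) : Fin n → Fin n → Set where
  here : ∀ {u} → Walk G u u
  step : ∀ {u w v} → Edge G u w → Walk G w v → Walk G u v

Connected : ∀ {n} → Graph n → Set
Connected {n} G = (1 ≤ n) × (∀ u v → Walk G u v)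

Consec : (k : ℕ) → Fin k → Fin k → Set
Consec k s t = (toℕ t ≡ suc (toℕ s)) ⊎ ((toℕ s ≡ k ∸ 1) × (toℕ t ≡ 0))

record Cycle {n} (G : Graph n) : Set where
  field
    len    : ℕ
    len≥3  : 3 ≤ len
    vtx    : Fin len → Fin n
    inj    : ∀ s t → vtx s ≡ vtx t → s ≡ t
    closed : ∀ s t → Consec len s t → Edge G (vtx s) (vtx t)

open Cycle public

CycleEdge : ∀ {n} {G : Graph n} → Cycle G → Fin n → Fin n → Set
CycleEdge C u v = ∃ λ s → ∃ λ t → Consec (len C) s t ×
  (((vtx C s ≡ u) × (vtx C t ≡ v)) ⊎ ((vtx C s ≡ v) × (vtx C t ≡ u)))

-- two cycles are the same cycle (same edge set as subgraphs)
SameCycle : ∀ {n} {G : Graph n} → Cycle G → Cycle G → Set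
SameCycle C D = ∀ u v → (CycleEdge C u v → CycleEdge D u v) × (CycleEdge D u v → CycleEdge C u v)

IsCactus : ∀ {n} → Graph n → Set
IsCactus G = Connected G ×
  (∀ (C D : Cycle G) u v → CycleEdge C u v → CycleEdge D u v → SameCycle C D)

Matrix : ℕ → Set
Matrix n = Vec (Vec Bool n) n

Arc : ∀ {n} → Matrix n → Fin n → Fin n → Set
Arc O i j = lookup (lookup O i) j ≡ true

data DWalk {n} (O : Matrix n) : Fin n → Fin n → Set where
  here : ∀ {u} → DWalk O u u
  step : ∀ {u w v} → Arc O u w → DWalk O w v → DWalk O u v

Acyclic : ∀ {n} → Matrix n → Set
Acyclic O = ∀ u v → Arc O u v → ¬ DWalk O v u

InDegZero : ∀ {n} → Matrix n → Fin n → Set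
InDegZero O v = ∀ j → ¬ Arc O j v

-- Applied to an orientation of a cactus
-- its underlying graph is that cactus, so this is a rooted cactus.
IsRootedAt : ∀ {n} → Matrix n → Fin n → Set
IsRootedAt O r = Acyclic O × InDegZero O r ×
  (∀ v → InDegZero O v → v ≡ r) × (∀ v → DWalk O r v)

IsOrientation : ∀ {n} → Graph n → Matrix n → Set
IsOrientation G O =
  (∀ i j → Arc O i j → Edge G i j) ×
  (∀ i j → Edge G i j → Arc O i j ⊎ Arc O j i) ×
  (∀ i j → Arc O i j → ¬ Arc O j i)

R : ∀ {n} → Graph n → Set
R {n} G = Σ (Fin n × Matrix n) λ { (r , O) → IsOrientation G O × IsRootedAt O r }

digraph : ∀ {n} {G : Graph n} → R G → Matrix n
digraph ((r , O) , _) = O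

GraphIso : ∀ {n m} → Graph n → Graph m → Set
GraphIso {n} {m} G H = Σ (Fin n ↔ Fin m) λ π →
  ∀ i j → adj G i j ≡ adj H (Inverse.to π i) (Inverse.to π j)

DigraphIso : ∀ {n m} → Matrix n → Matrix m → Set
DigraphIso {n} {m} O P = Σ (Fin n ↔ Fin m) λ π →
  ∀ i j → lookup (lookup O i) j ≡ lookup (lookup P (Inverse.to π i)) (Inverse.to π j)

-- R(G) ∼ R(H): a bijection f : R(G) → R(H) (elements compared by their
-- data (root, orientation)) with f(D) ≅ D for all D
RSim : ∀ {n m} → Graph n → Graph m → Set
RSim G H = Σ (R G → R H) λ f → Σ (R H → R G) λ g →
  (∀ x → proj₁ (g (f x)) ≡ proj₁ x) ×
  (∀ y → proj₁ (f (g y)) ≡ proj₁ y) ×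
  (∀ x → DigraphIso (digraph {G = H} (f x)) (digraph {G = G} x))

-- Relabelling vertices along a graph isomorphism transports rooted
-- orientations, and yields the required bijection R(G) → R(H) with each
-- digraph isomorphic to its image.  Conversely, an orientation determines
-- its underlying graph, so an isomorphism between a rooted orientation of G
-- and its image in R(H) is already an isomorphism G ≅ H; such an orientation
-- exists because G is connected: rank the vertices by their distance to a
-- fixed root (ties broken by index) and orient every edge upwards.
module Submission where

open import Defs hiding (sym)
open import Data.Nat
  using (ℕ; zero; suc; _+_; _*_; _≤_; _<_; _≤′_; ≤′-refl; ≤′-step; _<?_; z≤n; s≤s; NonZero)
open import Data.Nat.Properties
open import Data.Nat.DivMod using (_%_; [m+kn]%n≡m%n; m<n⇒m%n≡m)
open import Data.Nat.Induction using (<-wellFounded)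
open import Data.Fin using (Fin; toℕ) renaming (zero to fzero)
open import Data.Fin.Properties using (toℕ-injective; toℕ<n; any?) renaming (_≟_ to _≟ᶠ_)
open import Data.Bool using (Bool; true; false; _∧_; _∨_)
open import Data.Bool.Properties using (∧-identityʳ; ∧-zeroʳ) renaming (_≟_ to _≟ᵇ_)
open import Data.Vec using (tabulate; lookup)
open import Data.Vec.Properties using (lookup∘tabulate; tabulate∘lookup; tabulate-cong)
open import Data.Product using (Σ; ∃; _×_; _,_; proj₁; proj₂)
open import Data.Sum using (_⊎_; inj₁; inj₂)
open import Data.Empty using (⊥-elim)
open import Function using (id; _∘_; _on_)
open import Function.Bundles using (_⇔_; _↔_; Equivalence; Inverse; mk⇔)
open import Function.Properties.Inverse using (↔-sym)
open import Induction.WellFounded using (Acc; acc)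
open import Relation.Binary.Construct.On as On using ()
open import Relation.Binary.Definitions using (tri<; tri≈; tri>)
open import Relation.Binary.PropositionalEquality
open import Relation.Nullary using (¬_; yes; no; _×-dec_; _⊎-dec_)
open import Relation.Nullary.Decidable using (⌊_⌋)
open import Relation.Unary using (Decidable)

module _ {p} {P : ℕ → Set p} (P? : Decidable P) (P-suc : ∀ {j} → P j → P (suc j)) where

  P-mono : ∀ {i j} → i ≤ j → P i → P j
  P-mono i≤j = go (≤⇒≤′ i≤j)
    where
      go : ∀ {i j} → i ≤′ j → P i → P j
      go ≤′-refl       = id
      go (≤′-step i≤j) = P-suc ∘ go i≤j

  least : ∀ {k} → P k → Σ ℕ λ j → P j × (∀ {i} → P i → j ≤ i)
  least {zero}  Pk = zero , Pk , λ _ → z≤n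
  least {suc k} Pk with P? k
  ... | yes Pk′ = least Pk′
  ... | no ¬Pk′ = suc k , Pk , λ Pi → ≰⇒> (λ i≤k → ¬Pk′ (P-mono i≤k Pi))

low-digit-unique : ∀ {n x y a b} .{{_ : NonZero n}} → x < n → y < n →
                   x + a * n ≡ y + b * n → x ≡ y
low-digit-unique {n} {x} {y} {a} {b} x<n y<n eq = begin
  x                ≡⟨ m<n⇒m%n≡m x<n ⟨
  x % n            ≡⟨ [m+kn]%n≡m%n x a n ⟨
  (x + a * n) % n  ≡⟨ cong (_% n) eq ⟩
  (y + b * n) % n  ≡⟨ [m+kn]%n≡m%n y b n ⟩
  y % n            ≡⟨ m<n⇒m%n≡m y<n ⟩
  y                ∎
  where open ≡-Reasoning

high-digit-< : ∀ {n x y a b} → x < n → a < b → x + a * n < y + b * n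
high-digit-< {n} {x} {y} {a} {b} x<n a<b = begin-strict
  x + a * n  <⟨ +-monoˡ-< (a * n) x<n ⟩
  n + a * n  ≤⟨ *-monoˡ-≤ n a<b ⟩
  b * n      ≤⟨ m≤n+m (b * n) y ⟩
  y + b * n  ∎
  where open ≤-Reasoning

entry : ∀ {n} → Matrix n → Fin n → Fin n → Bool
entry O i j = lookup (lookup O i) j

matrix : ∀ {n} → (Fin n → Fin n → Bool) → Matrix n
matrix f = tabulate λ i → tabulate (f i)

entry-matrix : ∀ {n} (f : Fin n → Fin n → Bool) i j → entry (matrix f) i j ≡ f i j
entry-matrix f i j =
  trans (cong (λ row → lookup row j) (lookup∘tabulate (λ i → tabulate (f i)) i))
        (lookup∘tabulate (f i) j)

matrix-entry : ∀ {n} (O : Matrix n) → matrix (entry O) ≡ O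
matrix-entry O = trans (tabulate-cong λ i → tabulate∘lookup (lookup O i)) (tabulate∘lookup O)

matrix-cong : ∀ {n} {f g : Fin n → Fin n → Bool} →
              (∀ i j → f i j ≡ g i j) → matrix f ≡ matrix g
matrix-cong f≗g = tabulate-cong λ i → tabulate-cong (f≗g i)

_▷_ : ∀ {n} {O : Matrix n} {u w v} → DWalk O u w → Arc O w v → DWalk O u v
here       ▷ a = step a here
step b bs  ▷ a = step b (bs ▷ a)

edge-sym : ∀ {n} (G : Graph n) {u v} → Edge G u v → Edge G v u
edge-sym G {u} {v} e = trans (Graph.sym G v u) e

edge-irrefl : ∀ {n} (G : Graph n) {u} → ¬ Edge G u u
edge-irrefl G {u} e with () ← trans (sym e) (irrefl G u)

module RankedOrientation {n} (G : Graph n) (ρ : Fin n → ℕ) where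

  orientation : Matrix n
  orientation = matrix λ u v → adj G u v ∧ ⌊ ρ u <? ρ v ⌋

  arc⇔ : ∀ u v → Arc orientation u v ⇔ (Edge G u v × ρ u < ρ v)
  arc⇔ u v rewrite entry-matrix (λ u v → adj G u v ∧ ⌊ ρ u <? ρ v ⌋) u v
    with ρ u <? ρ v
  ... | yes ρu<ρv rewrite ∧-identityʳ (adj G u v) = mk⇔ (_, ρu<ρv) proj₁
  ... | no  ρu≮ρv rewrite ∧-zeroʳ (adj G u v) = mk⇔ (λ ()) (⊥-elim ∘ ρu≮ρv ∘ proj₂)

  arc⇒edge : ∀ {u v} → Arc orientation u v → Edge G u v
  arc⇒edge {u} {v} = proj₁ ∘ Equivalence.to (arc⇔ u v)

  arc⇒rank< : ∀ {u v} → Arc orientation u v → ρ u < ρ v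
  arc⇒rank< {u} {v} = proj₂ ∘ Equivalence.to (arc⇔ u v)

  edge⇒arc : ∀ {u v} → Edge G u v → ρ u < ρ v → Arc orientation u v
  edge⇒arc {u} {v} e ρu<ρv = Equivalence.from (arc⇔ u v) (e , ρu<ρv)

  dwalk⇒rank≤ : ∀ {u v} → DWalk orientation u v → ρ u ≤ ρ v
  dwalk⇒rank≤ here        = ≤-refl
  dwalk⇒rank≤ (step a as) = ≤-trans (<⇒≤ (arc⇒rank< a)) (dwalk⇒rank≤ as)

  isOrientation : (∀ {u v} → ρ u ≡ ρ v → u ≡ v) → IsOrientation G orientation
  isOrientation ρ-injective =
    (λ _ _ → arc⇒edge) , oriented , (λ _ _ a b → <-asym (arc⇒rank< a) (arc⇒rank< b))
    where
      oriented : ∀ u v → Edge G u v → Arc orientation u v ⊎ Arc orientation v u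
      oriented u v e with <-cmp (ρ u) (ρ v)
      ... | tri< ρu<ρv _ _ = inj₁ (edge⇒arc e ρu<ρv)
      ... | tri> _ _ ρv<ρu = inj₂ (edge⇒arc (edge-sym G e) ρv<ρu)
      ... | tri≈ _ ρu≡ρv _ =
        ⊥-elim (edge-irrefl G (subst (Edge G u) (sym (ρ-injective ρu≡ρv)) e))

  isRootedAt : ∀ r → (∀ v → ρ r ≤ ρ v) →
               (∀ v → v ≢ r → ∃ λ w → Edge G w v × ρ w < ρ v) →
               IsRootedAt orientation r
  isRootedAt r r-minimal descent =
    (λ u v a as → <⇒≱ (arc⇒rank< a) (dwalk⇒rank≤ as)) ,
    (λ v a → <⇒≱ (arc⇒rank< a) (r-minimal v)) ,
    source⇒root ,
    (λ v → reachable v (On.wellFounded ρ <-wellFounded v))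
    where
      source⇒root : ∀ v → InDegZero orientation v → v ≡ r
      source⇒root v no-in with v ≟ᶠ r
      ... | yes v≡r = v≡r
      ... | no  v≢r = let w , e , ρw<ρv = descent v v≢r in
        ⊥-elim (no-in w (edge⇒arc e ρw<ρv))

      reachable : ∀ v → Acc (_<_ on ρ) v → DWalk orientation r v
      reachable v (acc rs) with v ≟ᶠ r
      ... | yes refl = here
      ... | no  v≢r  = let w , e , ρw<ρv = descent v v≢r in
        reachable w (rs ρw<ρv) ▷ edge⇒arc e ρw<ρv

module DistanceRank {k} (G : Graph (suc k)) (walk : ∀ u v → Walk G u v) where

  root : Fin (suc k)
  root = fzero

  Within : ℕ → Fin (suc k) → Set
  Within zero    v = v ≡ root
  Within (suc j) v = Within j v ⊎ ∃ λ w → Edge G v w × Within j w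

  within? : ∀ j → Decidable (Within j)
  within? zero    v = v ≟ᶠ root
  within? (suc j) v = within? j v ⊎-dec any? λ w → (adj G v w ≟ᵇ true) ×-dec within? j w

  walk⇒within : ∀ {v} → Walk G v root → ∃ λ j → Within j v
  walk⇒within here       = zero , refl
  walk⇒within (step e w) = let j , within = walk⇒within w in suc j , inj₂ (_ , e , within)

  distance : ∀ v → Σ ℕ λ d → Within d v × (∀ {j} → Within j v → d ≤ j)
  distance v = least (λ j → within? j v) inj₁ (proj₂ (walk⇒within (walk v root)))

  dist : Fin (suc k) → ℕ
  dist v = proj₁ (distance v)

  dist-minimal : ∀ {v j} → Within j v → dist v ≤ j
  dist-minimal {v} = proj₂ (proj₂ (distance v))

  dist-root : dist root ≡ 0
  dist-root = n≤0⇒n≡0 (dist-minimal {root} refl)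

  dist-descent : ∀ v → v ≢ root → ∃ λ w → Edge G w v × dist w < dist v
  dist-descent v v≢root with distance v
  ... | zero  , v≡root , _ = ⊥-elim (v≢root v≡root)
  ... | suc j , inj₁ within , minimal = ⊥-elim (1+n≰n (minimal within))
  ... | suc j , inj₂ (w , e , within) , _ = w , edge-sym G e , s≤s (dist-minimal within)

  rank : Fin (suc k) → ℕ
  rank v = toℕ v + dist v * suc k

  rank-injective : ∀ {u v} → rank u ≡ rank v → u ≡ v
  rank-injective {u} {v} =
    toℕ-injective ∘ low-digit-unique {a = dist u} {b = dist v} (toℕ<n u) (toℕ<n v)

  rank-root-minimal : ∀ v → rank root ≤ rank v
  rank-root-minimal v rewrite dist-root = z≤n

  rank-descent : ∀ v → v ≢ root → ∃ λ w → Edge G w v × rank w < rank v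
  rank-descent v v≢root =
    let w , e , dw<dv = dist-descent v v≢root in w , e , high-digit-< (toℕ<n w) dw<dv

  open RankedOrientation G rank

  rooted-orientation : R G
  rooted-orientation =
    (root , orientation) ,
    isOrientation rank-injective ,
    isRootedAt root rank-root-minimal rank-descent

connected⇒R : ∀ {n} (G : Graph n) → Connected G → R G
connected⇒R {suc k} G (_ , walk) = DistanceRank.rooted-orientation G walk

relabel : ∀ {n m} → (Fin m → Fin n) → Matrix n → Matrix m
relabel f O = matrix λ i j → entry O (f i) (f j)

entry-relabel : ∀ {n m} (f : Fin m → Fin n) (O : Matrix n) i j →
                entry (relabel f O) i j ≡ entry O (f i) (f j)
entry-relabel f O = entry-matrix λ i j → entry O (f i) (f j)

relabel-inverse : ∀ {n m} {f : Fin m → Fin n} {g : Fin n → Fin m} →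
                  (∀ x → g (f x) ≡ x) → ∀ O → relabel f (relabel g O) ≡ O
relabel-inverse {f = f} {g} gf O = trans (matrix-cong entries) (matrix-entry O)
  where
    entries : ∀ i j → entry (relabel g O) (f i) (f j) ≡ entry O i j
    entries i j = trans (entry-relabel g O (f i) (f j)) (cong₂ (entry O) (gf i) (gf j))

module _ {n m} (f : Fin m → Fin n) {O : Matrix n} where

  arc-relabel⁻ : ∀ {i j} → Arc (relabel f O) i j → Arc O (f i) (f j)
  arc-relabel⁻ {i} {j} = trans (sym (entry-relabel f O i j))

  dwalk-relabel⁻ : ∀ {i j} → DWalk (relabel f O) i j → DWalk O (f i) (f j)
  dwalk-relabel⁻ here        = here
  dwalk-relabel⁻ (step a as) = step (arc-relabel⁻ a) (dwalk-relabel⁻ as)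

  isOrientation-relabel : ∀ {G : Graph n} {H : Graph m} →
                          (∀ i j → adj H i j ≡ adj G (f i) (f j)) →
                          IsOrientation G O → IsOrientation H (relabel f O)
  isOrientation-relabel {G} {H} adj≡ (arc⇒edge , oriented , antisym) =
    (λ i j → edge⁺ i j ∘ arc⇒edge (f i) (f j) ∘ arc-relabel⁻) ,
    (λ i j → orient⁺ i j ∘ oriented (f i) (f j) ∘ trans (sym (adj≡ i j))) ,
    (λ i j a b → antisym (f i) (f j) (arc-relabel⁻ a) (arc-relabel⁻ b))
    where
      edge⁺ : ∀ i j → Edge G (f i) (f j) → Edge H i j
      edge⁺ i j = trans (adj≡ i j)

      arc⁺ : ∀ i j → Arc O (f i) (f j) → Arc (relabel f O) i j
      arc⁺ i j = trans (entry-relabel f O i j)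

      orient⁺ : ∀ i j → Arc O (f i) (f j) ⊎ Arc O (f j) (f i) →
                Arc (relabel f O) i j ⊎ Arc (relabel f O) j i
      orient⁺ i j (inj₁ a) = inj₁ (arc⁺ i j a)
      orient⁺ i j (inj₂ a) = inj₂ (arc⁺ j i a)

module _ {n m} (π : Fin n ↔ Fin m) {O : Matrix n} where
  open Inverse π using (to; from)
    renaming (strictlyInverseˡ to to∘from; strictlyInverseʳ to from∘to)

  arc-relabel : ∀ {a b} → Arc O a b → Arc (relabel from O) (to a) (to b)
  arc-relabel {a} {b} =
    trans (trans (entry-relabel from O (to a) (to b)) (cong₂ (entry O) (from∘to a) (from∘to b)))

  dwalk-relabel : ∀ {a b} → DWalk O a b → DWalk (relabel from O) (to a) (to b)
  dwalk-relabel here        = here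
  dwalk-relabel (step a as) = step (arc-relabel a) (dwalk-relabel as)

  isRootedAt-relabel : ∀ {r} → IsRootedAt O r → IsRootedAt (relabel from O) (to r)
  isRootedAt-relabel {r} (acyclic , r-source , sources≡r , r-reaches) =
    (λ u v a as →
      acyclic (from u) (from v) (arc-relabel⁻ from {O} a) (dwalk-relabel⁻ from {O} as)) ,
    (λ j a → r-source (from j) (subst (Arc O (from j)) (from∘to r) (arc-relabel⁻ from {O} a))) ,
    (λ v no-in → trans (sym (to∘from v)) (cong to (sources≡r (from v) (source⁻ v no-in)))) ,
    (λ v → subst (DWalk (relabel from O) (to r)) (to∘from v) (dwalk-relabel (r-reaches (from v))))
    where
      source⁻ : ∀ v → InDegZero (relabel from O) v → InDegZero O (from v)
      source⁻ v no-in j a =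
        no-in (to j) (subst (Arc (relabel from O) (to j)) (to∘from v) (arc-relabel a))

graphIso-sym : ∀ {n m} (G : Graph n) (H : Graph m) → GraphIso G H → GraphIso H G
graphIso-sym G H (π , adj≡) = ↔-sym π , λ i j →
  trans (cong₂ (adj H) (sym (to∘from i)) (sym (to∘from j))) (sym (adj≡ (from i) (from j)))
  where open Inverse π using (from) renaming (strictlyInverseˡ to to∘from)

R-map : ∀ {n m} (G : Graph n) (H : Graph m) → GraphIso G H → R G → R H
R-map G H iso@(π , _) ((r , O) , oriented , rooted) =
  (to r , relabel from O) ,
  isOrientation-relabel from {O} {G} {H} (proj₂ (graphIso-sym G H iso)) oriented ,
  isRootedAt-relabel π {O} rooted
  where open Inverse π using (to; from)

graphIso⇒RSim : ∀ {n m} (G : Graph n) (H : Graph m) → GraphIso G H → RSim G H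
graphIso⇒RSim G H iso@(π , _) =
  R-map G H iso , R-map H G (graphIso-sym G H iso) ,
  (λ { ((r , O) , _) → cong₂ _,_ (from∘to r) (relabel-inverse {f = to} {g = from} from∘to O) }) ,
  (λ { ((r , O) , _) → cong₂ _,_ (to∘from r) (relabel-inverse {f = from} {g = to} to∘from O) }) ,
  (λ { ((r , O) , _) → ↔-sym π , entry-relabel from O })
  where
    open Inverse π using (to; from)
      renaming (strictlyInverseˡ to to∘from; strictlyInverseʳ to from∘to)

adj≡arc∨arc : ∀ {n} (G : Graph n) (O : Matrix n) → IsOrientation G O →
              ∀ i j → adj G i j ≡ entry O i j ∨ entry O j i
adj≡arc∨arc G O (arc⇒edge , oriented , _) i j
  with adj G i j in e | entry O i j in a | entry O j i in b
... | true  | true  | _     = refl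
... | true  | false | true  = refl
... | true  | false | false with oriented i j e
...   | inj₁ arc with () ← trans (sym a) arc
...   | inj₂ arc with () ← trans (sym b) arc
adj≡arc∨arc G O (arc⇒edge , _ , _) i j
    | false | true  | _     with () ← trans (sym e) (arc⇒edge i j a)
adj≡arc∨arc G O (arc⇒edge , _ , _) i j
    | false | false | true  with () ← trans (sym e) (edge-sym G (arc⇒edge j i b))
adj≡arc∨arc G O _ i j
    | false | false | false = refl

digraphIso⇒graphIso : ∀ {n m} (G : Graph n) (H : Graph m) (O : Matrix n) (P : Matrix m) →
                      IsOrientation G O → IsOrientation H P → DigraphIso P O → GraphIso H G
digraphIso⇒graphIso G H O P oG oH (σ , entry≡) = σ , λ i j → begin
  adj H i j                                      ≡⟨ adj≡arc∨arc H P oH i j ⟩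
  entry P i j ∨ entry P j i                      ≡⟨ cong₂ _∨_ (entry≡ i j) (entry≡ j i) ⟩
  entry O (to i) (to j) ∨ entry O (to j) (to i)  ≡⟨ adj≡arc∨arc G O oG (to i) (to j) ⟨
  adj G (to i) (to j)                            ∎
  where
    open ≡-Reasoning
    open Inverse σ using (to)

RSim⇒graphIso : ∀ {n m} (G : Graph n) (H : Graph m) →
                Connected G → RSim G H → GraphIso G H
RSim⇒graphIso G H connected (f , _ , _ , _ , f≅) =
  graphIso-sym H G
    (digraphIso⇒graphIso G H (digraph {G = G} x) (digraph {G = H} (f x))
                            (isOrientation G x) (isOrientation H (f x)) (f≅ x))
  where
    x : R G
    x = connected⇒R G connected

    isOrientation : ∀ {k} (K : Graph k) (y : R K) → IsOrientation K (digraph {G = K} y)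
    isOrientation _ (_ , oriented , _) = oriented

lemma5 : ∀ {n m} (G : Graph n) (H : Graph m) → IsCactus G → IsCactus H →
    GraphIso G H ⇔ RSim G H
lemma5 G H (connected , _) _ = mk⇔ (graphIso⇒RSim G H) (RSim⇒graphIso G H connected)
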